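{- Let $P$, $G$, $L_{ij}$ and $R_{ij}$ be as defined below, and let $T$ be an $L_{ij}$ partial tour subgraph. Order the vertices of $R_{ij}$ from bottom to top. If $a<b<c<d$ are vertices of $R_{ij}$ of positive degree in $T$ such that $a$ and $c$ lie in the same connected component of $T$ and $b$ and $d$ lie in the same connected component of $T$, then $a,b,c,d$ all lie in the same connected component of $T$. In other words, the partition of the positive-degree vertices of $R_{ij}$ induced by the connected components of $T$ is a non-crossing partition.
   Context: $P$ is a finite set of points in the plane. Let $h$ (resp. $v$) be the number of distinct horizontal (resp. vertical) lines containing points of $P$; index horizontal lines $1,\dots,h$ from bottom to top and vertical lines $1,\dots,v$ from left to right, and let $v_{ij}$ be the intersection of horizontal line $i$ and vertical line $j$. $G$ is the undirected multigraph, embedded in the plane along the grid lines, with vertex set $\{v_{ij}\}$ having, for each pair of consecutive intersection points on a common line, two parallel edges joining them, of length equal to their $l_1$ distance. A tour subgraph of $G$ is a sub-multigraph $T$ such that every point of $P$ is a vertex of $T$ and the edges of $T$ can be oriented to form a closed walk using each edge exactly once. $L_{ij}$ is the sub-multigraph of $G$ induced by the vertices $v_{r,c}$ with ($r \le i$ and $c \le j$) or ($r > i$ and $c \le j-1$). $R_{ij}$ is the set consisting, for each horizontal line $r$, of the rightmost vertex of $L_{ij}$ on that line. An $L_{ij}$ partial tour subgraph is a sub-multigraph $T$ of $L_{ij}$ for which there exists a sub-multigraph $F$ of $G$ containing no edge of $L_{ij}$ such that $T \cup F$ is a tour subgraph of $G$. -}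

module Defs where

open import Level using (0ℓ)
open import Data.Nat using (ℕ; zero; suc; _≤_; _<_; _>_; _∸_)
open import Data.Fin using (Fin)
open import Data.Product using (Σ; ∃; ∃-syntax; _×_; _,_; proj₁; proj₂)
open import Data.Sum using (_⊎_)
open import Data.List using (List; []; _∷_)
open import Data.List.Membership.Propositional using (_∈_)
open import Data.List.Relation.Unary.All using (All)
open import Data.List.Relation.Unary.Any using (Any)
open import Data.List.Relation.Unary.Unique.Propositional using (Unique)
open import Relation.Binary.PropositionalEquality using (_≡_)
open import Relation.Nullary using (¬_)

-- Grid vertices v_{ij}:  (i , j) = (horizontal line index, vertical line index),
-- both 1-indexed (rows bottom to top, columns left to right).

Vertex : Set
Vertex = ℕ × ℕ

row : Vertex → ℕ
row = proj₁

col : Vertex → ℕ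
col = proj₂

-- For each pair of consecutive intersection points on a common
-- line there are two parallel edges, distinguished by a copy index in Fin 2.
--   hE r c k : the k-th edge joining v_{r,c} and v_{r,c+1}
--   vE r c k : the k-th edge joining v_{r,c} and v_{r+1,c}
data Edge : Set where
  hE : ℕ → ℕ → Fin 2 → Edge
  vE : ℕ → ℕ → Fin 2 → Edge

end₁ : Edge → Vertex
end₁ (hE r c _) = r , c
end₁ (vE r c _) = r , c

end₂ : Edge → Vertex
end₂ (hE r c _) = r , suc c
end₂ (vE r c _) = suc r , c

Incident : Edge → Vertex → Set
Incident e x = (end₁ e ≡ x) ⊎ (end₂ e ≡ x)

Joins : Edge → Vertex → Vertex → Set
Joins e x y = ((end₁ e ≡ x) × (end₂ e ≡ y)) ⊎ ((end₁ e ≡ y) × (end₂ e ≡ x))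

-- The point set P, given by the grid positions of its points.
-- h, v are the numbers of horizontal / vertical lines containing points of P.

ValidV : ℕ → ℕ → Vertex → Set
ValidV h v (r , c) = (1 ≤ r × r ≤ h) × (1 ≤ c × c ≤ v)

ValidE : ℕ → ℕ → Edge → Set
ValidE h v e = ValidV h v (end₁ e) × ValidV h v (end₂ e)

record PointSet (h v : ℕ) : Set where
  field
    points   : List Vertex
    onGrid   : All (ValidV h v) points
    rowsUsed : ∀ r → 1 ≤ r → r ≤ h → Any (λ p → row p ≡ r) points
    colsUsed : ∀ c → 1 ≤ c → c ≤ v → Any (λ p → col p ≡ c) points
open PointSet public

record MG : Set₁ where
  field
    V      : Vertex → Set
    E      : Edge → Set
    closed : ∀ e → E e → V (end₁ e) × V (end₂ e)
open MG public

G : ℕ → ℕ → MG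
G h v = record { V = ValidV h v ; E = ValidE h v ; closed = λ e p → p }

_⊑_ : MG → MG → Set
S ⊑ T = (∀ x → V S x → V T x) × (∀ e → E S e → E T e)

_∪_ : MG → MG → MG
S ∪ T = record
  { V = λ x → V S x ⊎ V T x
  ; E = λ e → E S e ⊎ E T e
  ; closed = cl }
  where
  cl : ∀ e → (E S e ⊎ E T e) → (V S (end₁ e) ⊎ V T (end₁ e)) × (V S (end₂ e) ⊎ V T (end₂ e))
  cl e (_⊎_.inj₁ p) = _⊎_.inj₁ (proj₁ (closed S e p)) , _⊎_.inj₁ (proj₂ (closed S e p))
  cl e (_⊎_.inj₂ p) = _⊎_.inj₂ (proj₁ (closed T e p)) , _⊎_.inj₂ (proj₂ (closed T e p))

induced : ℕ → ℕ → (Vertex → Set) → MG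
induced h v W = record
  { V = λ x → ValidV h v x × W x
  ; E = λ e → (ValidE h v e × W (end₁ e)) × W (end₂ e)
  ; closed = λ e p → (proj₁ (proj₁ (proj₁ p)) , proj₂ (proj₁ p))
                   , (proj₂ (proj₁ (proj₁ p)) , proj₂ p) }

data Walk : Vertex → Vertex → List Edge → Set where
  nil  : ∀ {x} → Walk x x []
  cons : ∀ {x y z e es} → Joins e x y → Walk y z es → Walk x z (e ∷ es)

IsTour : ∀ {h v} → PointSet h v → MG → Set
IsTour P T =
  All (V T) (points P) ×
  ∃[ s ] ∃[ es ] (Walk s s es × Unique es × (∀ e → (E T e → e ∈ es) × (e ∈ es → E T e))
                  × (∀ x → V T x → (x ≡ s) ⊎ Any (λ e → Incident e x) es))

Lset : ℕ → ℕ → Vertex → Set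
Lset i j (r , c) = (r ≤ i × c ≤ j) ⊎ (r > i × c ≤ j ∸ 1)

L : ℕ → ℕ → ℕ → ℕ → MG
L h v i j = induced h v (Lset i j)

R : ℕ → ℕ → ℕ → ℕ → Vertex → Set
R h v i j x = V (L h v i j) x × (∀ y → V (L h v i j) y → row y ≡ row x → col y ≤ col x)

IsPartialTour : ∀ {h v} → PointSet h v → ℕ → ℕ → MG → Set₁
IsPartialTour {h} {v} P i j T =
  T ⊑ L h v i j ×
  Σ MG (λ F → F ⊑ G h v × (∀ e → E F e → ¬ E (L h v i j) e) × IsTour P (T ∪ F))

PosDeg : MG → Vertex → Set
PosDeg T x = ∃[ e ] (E T e × Incident e x)

SameComponent : MG → Vertex → Vertex → Set
SameComponent T x y = V T x × V T y × ∃[ es ] (Walk x y es × All (E T) es)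

-- Let Q be a walk from a to c in T and close it into a curve by an arc from c
-- back to a running to the right of L; since L is a staircase and a, c are
-- rightmost on their rows, the arc meets L only at a and c.  The parity of the
-- crossings of this curve with the rightward horizontal ray from a vertex is
-- unchanged along every edge of L that does not touch Q.  On R the ray leaves
-- L at once, so the parity is 1 at b, whose row lies between those of a and c,
-- and 0 at d, above c.  Hence the walk from b to d in T touches Q, and b lies
-- in the component of a.
module Submission where

open import Defs
open import Data.Nat using (ℕ; suc; _≤_; _<_; _≟_; _≤?_; _<?_)
open import Data.Nat.Properties
  using (suc-injective; <-irrefl; ≤-reflexive; <⇒≤; <⇒≱; ≤∧≢⇒<; m≤n⇒m≤1+n; ≤-pred; <-trans)
open import Data.Bool using (Bool; true; false; _∧_; _xor_)
open import Data.Bool.Properties using (xor-same; xor-comm; xor-assoc; ∧-zeroʳ; ∧-identityʳ; xor-∧-commutativeRing)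
open import Data.Product using (∃-syntax; _×_; _,_; proj₁; proj₂)
open import Data.Product.Properties using (≡-dec; ×-≡,≡→≡)
open import Data.Sum using (_⊎_; inj₁; inj₂)
import Data.Sum as Sum
open import Data.List using (List; []; _∷_)
open import Data.List.Relation.Unary.All as All using (All; []; _∷_)
open import Data.List.Relation.Unary.All.Properties using (¬Any⇒All¬)
open import Data.List.Relation.Unary.Any using (Any; here; there; any?)
open import Data.Empty using (⊥-elim)
open import Function using (_∘_; mk⇔)
open import Relation.Nullary using (¬_; Dec; yes; no; does; _⊎-dec_; contradiction)
open import Relation.Nullary.Decidable using (dec-true; dec-false; does-⇔)
open import Relation.Binary.PropositionalEquality
open import Algebra.Bundles using (CommutativeRing)
open import Algebra.Properties.CommutativeSemigroup
  (CommutativeRing.+-commutativeSemigroup xor-∧-commutativeRing) using (interchange)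

_≟ᵥ_ : (x y : Vertex) → Dec (x ≡ y)
_≟ᵥ_ = ≡-dec _≟_ _≟_

incident? : ∀ e x → Dec (Incident e x)
incident? e x = (end₁ e ≟ᵥ x) ⊎-dec (end₂ e ≟ᵥ x)

Joins-sym : ∀ {e x y} → Joins e x y → Joins e y x
Joins-sym (inj₁ p) = inj₂ p
Joins-sym (inj₂ p) = inj₁ p

Joins-incident : ∀ {e x y z} → Joins e x y → Incident e z → z ≡ x ⊎ z ≡ y
Joins-incident (inj₁ (refl , refl)) (inj₁ refl) = inj₁ refl
Joins-incident (inj₁ (refl , refl)) (inj₂ refl) = inj₂ refl
Joins-incident (inj₂ (refl , refl)) (inj₁ refl) = inj₂ refl
Joins-incident (inj₂ (refl , refl)) (inj₂ refl) = inj₁ refl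

Connected : MG → Vertex → Vertex → Set
Connected T x y = ∃[ es ] (Walk x y es × All (E T) es)

module Connectivity (T : MG) where

  connected-refl : ∀ {x} → Connected T x x
  connected-refl = [] , nil , []

  connected-trans : ∀ {x y z} → Connected T x y → Connected T y z → Connected T x z
  connected-trans ([] , nil , []) q = q
  connected-trans (e ∷ es , cons j w , pe ∷ pes) q with connected-trans (es , w , pes) q
  ... | fs , w′ , pfs = e ∷ fs , cons j w′ , pe ∷ pfs

  connected-edge : ∀ {e x y} → Joins e x y → E T e → Connected T x y
  connected-edge {e} j pe = e ∷ [] , cons j nil , pe ∷ []

  connected-incident : ∀ {x y z es} → Walk x y es → All (E T) es →
                       Any (λ e → Incident e z) es → Connected T x z
  connected-incident (cons j w) (pe ∷ pes) (here inc) with Joins-incident j inc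
  ... | inj₁ refl = connected-refl
  ... | inj₂ refl = connected-edge j pe
  connected-incident (cons j w) (pe ∷ pes) (there inc) =
    connected-trans (connected-edge j pe) (connected-incident w pes inc)

xor-≡false⇒≡ : ∀ x y → x xor y ≡ false → x ≡ y
xor-≡false⇒≡ false false _ = refl
xor-≡false⇒≡ true  true  _ = refl

xor-cancel-middle : ∀ x y z → (x xor y) xor (y xor z) ≡ x xor z
xor-cancel-middle x y z = begin
  (x xor y) xor (y xor z)  ≡⟨ xor-assoc x y (y xor z) ⟩
  x xor (y xor (y xor z))  ≡⟨ cong (x xor_) (sym (xor-assoc y y z)) ⟩
  x xor ((y xor y) xor z)  ≡⟨ cong (λ t → x xor (t xor z)) (xor-same y) ⟩
  x xor z                  ∎
  where open ≡-Reasoning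

parity : (Edge → Bool) → List Edge → Bool
parity f []       = false
parity f (e ∷ es) = f e xor parity f es

parity-xor : ∀ f g es → parity f es xor parity g es ≡ parity (λ e → f e xor g e) es
parity-xor f g []       = refl
parity-xor f g (e ∷ es) =
  trans (interchange (f e) (parity f es) (g e) (parity g es))
        (cong ((f e xor g e) xor_) (parity-xor f g es))

parity-cong : ∀ {f g es} → All (λ e → f e ≡ g e) es → parity f es ≡ parity g es
parity-cong []       = refl
parity-cong (p ∷ ps) = cong₂ _xor_ p (parity-cong ps)

parity-false : ∀ {f es} → All (λ e → f e ≡ false) es → parity f es ≡ false
parity-false []       = refl
parity-false (p ∷ ps) = cong₂ _xor_ p (parity-false ps)

parity-telescopes : ∀ {f} (g : Vertex → Bool) {s t es} → Walk s t es →
                    All (λ e → f e ≡ g (end₁ e) xor g (end₂ e)) es →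
                    parity f es ≡ g s xor g t
parity-telescopes g {s} nil [] = sym (xor-same (g s))
parity-telescopes {f} g {s} {t} (cons {y = y} {e = e} {es = es} j w) (p ∷ ps) = begin
  f e xor parity f es              ≡⟨ cong₂ _xor_ (trans p (oriented j)) (parity-telescopes g w ps) ⟩
  (g s xor g y) xor (g y xor g t)  ≡⟨ xor-cancel-middle (g s) (g y) (g t) ⟩
  g s xor g t                      ∎
  where
  open ≡-Reasoning
  oriented : Joins e s y → g (end₁ e) xor g (end₂ e) ≡ g s xor g y
  oriented (inj₁ (refl , refl)) = refl
  oriented (inj₂ (refl , refl)) = xor-comm (g (end₁ e)) (g (end₂ e))

does-∧-cong : ∀ {A : Set} (a? : Dec A) {x y} → (A → x ≡ y) → does a? ∧ x ≡ does a? ∧ y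
does-∧-cong (yes a) x≡y = x≡y a
does-∧-cong (no _)  _   = refl

-- The ray from x to the right at height row x + ½; of the edges of G only
-- the vertical edges vE (row x) c with col x < c cross it.
crossesRay : Vertex → Edge → Bool
crossesRay x (hE _ _ _) = false
crossesRay x (vE r c _) = does (r ≟ row x) ∧ does (col x <? c)

winding : List Edge → Vertex → Bool
winding es x = parity (crossesRay x) es

onRightRay : Vertex → Vertex → Bool
onRightRay y x = does (row x ≟ row y) ∧ does (col y <? col x)

<?-suc-right : ∀ m n → n ≢ m → does (m <? n) ≡ does (m <? suc n)
<?-suc-right m n n≢m =
  does-⇔ (mk⇔ m≤n⇒m≤1+n (λ m<1+n → ≤∧≢⇒< (≤-pred m<1+n) (n≢m ∘ sym))) (m <? n) (m <? suc n)

<?-suc-left : ∀ m n → n ≢ suc m → does (m <? n) ≡ does (suc m <? n)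
<?-suc-left m n n≢1+m =
  does-⇔ (mk⇔ (λ m<n → ≤∧≢⇒< m<n (λ eq → n≢1+m (sym eq))) <⇒≤) (m <? n) (suc m <? n)

crossesRay-horizontal : ∀ {r c} e → ¬ Incident e (r , suc c) →
                        crossesRay (r , c) e ≡ crossesRay (r , suc c) e
crossesRay-horizontal         (hE _ _ _)   _    = refl
crossesRay-horizontal {r} {c} (vE r′ c′ _) ¬inc =
  does-∧-cong (r′ ≟ r) {does (c <? c′)} λ { refl → <?-suc-left c c′ λ { refl → ¬inc (inj₁ refl) } }

crossesRay-vertical : ∀ {r c} e → ¬ Incident e (suc r , c) →
                      crossesRay (r , c) e xor crossesRay (suc r , c) e
                        ≡ onRightRay (suc r , c) (end₁ e) xor onRightRay (suc r , c) (end₂ e)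
crossesRay-vertical {r} {c} (hE r′ c′ _) ¬inc = sym (trans
  (cong (_xor does (r′ ≟ suc r) ∧ does (c <? suc c′))
        (does-∧-cong (r′ ≟ suc r) {does (c <? c′)} {does (c <? suc c′)}
          λ { refl → <?-suc-right c c′ λ { refl → ¬inc (inj₁ refl) } }))
  (xor-same (does (r′ ≟ suc r) ∧ does (c <? suc c′))))
crossesRay-vertical {r} {c} (vE r′ c′ _) _ =
  trans (cong (λ t → t ∧ does (c <? c′) xor does (r′ ≟ suc r) ∧ does (c <? c′))
              (does-⇔ (mk⇔ (cong suc) suc-injective) (r′ ≟ r) (suc r′ ≟ suc r)))
        (xor-comm (does (suc r′ ≟ suc r) ∧ does (c <? c′)) (does (r′ ≟ suc r) ∧ does (c <? c′)))

winding-horizontal : ∀ {r c es} → All (λ e → ¬ Incident e (r , suc c)) es →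
                     winding es (r , c) ≡ winding es (r , suc c)
winding-horizontal untouched = parity-cong (All.map (crossesRay-horizontal _) untouched)

winding-vertical : ∀ {r c s t es} → Walk s t es → All (λ e → ¬ Incident e (suc r , c)) es →
                   winding es (r , c) xor winding es (suc r , c)
                     ≡ onRightRay (suc r , c) s xor onRightRay (suc r , c) t
winding-vertical {r} {c} {es = es} w untouched =
  trans (parity-xor (crossesRay (r , c)) (crossesRay (suc r , c)) es)
        (parity-telescopes (onRightRay (suc r , c)) w (All.map (crossesRay-vertical _) untouched))

module _ {h v i j : ℕ} where

  winding-R : ∀ {x es} → R h v i j x → All (E (L h v i j)) es → winding es x ≡ false
  winding-R {x} Rx esL = parity-false (All.map (λ {e} → noCrossing e) esL)
    where
    noCrossing : ∀ e → E (L h v i j) e → crossesRay x e ≡ false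
    noCrossing (hE _ _ _) _ = refl
    noCrossing (vE r′ c′ k) eL = trans
      (does-∧-cong (r′ ≟ row x) {y = false} λ r′≡ → dec-false (col x <? c′) λ x<c′ →
        <⇒≱ x<c′ (proj₂ Rx (r′ , c′) (proj₁ (closed (L h v i j) (vE r′ c′ k) eL)) r′≡))
      (∧-zeroʳ _)

  onRightRay-R : ∀ {x y} → R h v i j x → V (L h v i j) y → y ≢ x →
                onRightRay y x ≡ does (row x ≟ row y)
  onRightRay-R {x} {y} Rx Vy y≢x = trans
    (does-∧-cong (row x ≟ row y) {y = true} λ rx≡ry → dec-true (col y <? col x)
      (≤∧≢⇒< (proj₂ Rx y Vy (sym rx≡ry)) λ cy≡cx → y≢x (×-≡,≡→≡ (sym rx≡ry , cy≡cx))))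
    (∧-identityʳ _)

≤?-xor-suc : ∀ m r → does (m ≤? r) xor does (m ≤? suc r) ≡ does (m ≟ suc r)
≤?-xor-suc m r = by (m ≟ suc r)
  where
  by : (m≟1+r : Dec (m ≡ suc r)) → does (m ≤? r) xor does (m ≤? suc r) ≡ does m≟1+r
  by (yes m≡1+r) = cong₂ _xor_
    (dec-false (m ≤? r) λ m≤r → <-irrefl refl (subst (_≤ r) m≡1+r m≤r))
    (dec-true (m ≤? suc r) (≤-reflexive m≡1+r))
  by (no m≢1+r) = trans
    (cong (_xor does (m ≤? suc r))
          (does-⇔ (mk⇔ m≤n⇒m≤1+n λ m≤1+r → ≤-pred (≤∧≢⇒< m≤1+r m≢1+r)) (m ≤? r) (m ≤? suc r)))
    (xor-same (does (m ≤? suc r)))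

module Separation {h v i j : ℕ} (T : MG) (T⊑L : T ⊑ L h v i j)
                  {a c qs} (Ra : R h v i j a) (Rc : R h v i j c)
                  (Q : Walk a c qs) (Q⊆T : All (E T) qs) where

  open Connectivity T

  -- Crossing parity of the ray from x with Q closed up by an arc from c back
  -- to a outside L; that arc crosses the ray iff x lies on a row from the
  -- lower to (excluding) the upper of row a and row c.
  betweenRows : ℕ → Bool
  betweenRows r = does (row a ≤? r) xor does (row c ≤? r)

  side : Vertex → Bool
  side x = winding qs x xor betweenRows (row x)

  side-R : ∀ {x} → R h v i j x → side x ≡ betweenRows (row x)
  side-R {x} Rx = cong (_xor betweenRows (row x)) (winding-R Rx (All.map (λ {e} → proj₂ T⊑L e) Q⊆T))

  reached-or-untouched : ∀ y → Connected T a y ⊎ All (λ e → ¬ Incident e y) qs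
  reached-or-untouched y with any? (λ e → incident? e y) qs
  ... | yes touched = inj₁ (connected-incident Q Q⊆T touched)
  ... | no ¬touched = inj₂ (¬Any⇒All¬ qs ¬touched)

  side-vertical : ∀ {r c₀} → V (L h v i j) (suc r , c₀) → (suc r , c₀) ≢ a → (suc r , c₀) ≢ c →
                  All (λ e → ¬ Incident e (suc r , c₀)) qs → side (r , c₀) ≡ side (suc r , c₀)
  side-vertical {r} {c₀} Vy y≢a y≢c untouched = xor-≡false⇒≡ _ _ (begin
    side (r , c₀) xor side (suc r , c₀)
      ≡⟨ interchange (winding qs (r , c₀)) (betweenRows r) (winding qs (suc r , c₀)) (betweenRows (suc r)) ⟩
    (winding qs (r , c₀) xor winding qs (suc r , c₀)) xor (betweenRows r xor betweenRows (suc r))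
      ≡⟨ cong₂ _xor_ (winding-vertical Q untouched)
                     (interchange (does (row a ≤? r)) (does (row c ≤? r))
                                  (does (row a ≤? suc r)) (does (row c ≤? suc r))) ⟩
    (onRightRay y a xor onRightRay y c)
      xor ((does (row a ≤? r) xor does (row a ≤? suc r)) xor (does (row c ≤? r) xor does (row c ≤? suc r)))
      ≡⟨ cong₂ _xor_ (cong₂ _xor_ (onRightRay-R Ra Vy y≢a) (onRightRay-R Rc Vy y≢c))
                     (cong₂ _xor_ (≤?-xor-suc (row a) r) (≤?-xor-suc (row c) r)) ⟩
    (does (row a ≟ suc r) xor does (row c ≟ suc r)) xor (does (row a ≟ suc r) xor does (row c ≟ suc r))
      ≡⟨ xor-same (does (row a ≟ suc r) xor does (row c ≟ suc r)) ⟩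
    false ∎)
    where
    open ≡-Reasoning
    y = (suc r , c₀)

  side-edge : ∀ e → E (L h v i j) e → Connected T a (end₂ e) ⊎ side (end₁ e) ≡ side (end₂ e)
  side-edge (hE r c₀ _) _ with reached-or-untouched (r , suc c₀)
  ... | inj₁ reached   = inj₁ reached
  ... | inj₂ untouched = inj₂ (cong (_xor betweenRows r) (winding-horizontal untouched))
  side-edge (vE r c₀ k) eL
    with (suc r , c₀) ≟ᵥ a | (suc r , c₀) ≟ᵥ c | reached-or-untouched (suc r , c₀)
  ... | yes y≡a | _       | _              = inj₁ (subst (Connected T a) (sym y≡a) connected-refl)
  ... | no _    | yes y≡c | _              = inj₁ (subst (Connected T a) (sym y≡c) (qs , Q , Q⊆T))
  ... | no _    | no _    | inj₁ reached   = inj₁ reached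
  ... | no y≢a  | no y≢c  | inj₂ untouched =
    inj₂ (side-vertical (proj₂ (closed (L h v i j) (vE r c₀ k) eL)) y≢a y≢c untouched)

  side-joins : ∀ {e x y} → Joins e x y → E (L h v i j) e →
               (Connected T a x ⊎ Connected T a y) ⊎ side x ≡ side y
  side-joins {e} (inj₁ (refl , refl)) eL = Sum.map₁ inj₂ (side-edge e eL)
  side-joins {e} (inj₂ (refl , refl)) eL = Sum.map inj₁ sym (side-edge e eL)

  connected-if-sides-differ : ∀ {x y ps} → Walk x y ps → All (E T) ps → side x ≢ side y →
                              Connected T a x
  connected-if-sides-differ nil [] differ = ⊥-elim (differ refl)
  connected-if-sides-differ (cons {e = e} j w) (pe ∷ pes) differ with side-joins j (proj₂ T⊑L e pe)
  ... | inj₁ (inj₁ a~x) = a~x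
  ... | inj₁ (inj₂ a~y) = connected-trans a~y (connected-edge (Joins-sym j) pe)
  ... | inj₂ same       = connected-trans
    (connected-if-sides-differ w pes (λ same′ → differ (trans same same′)))
    (connected-edge (Joins-sym j) pe)

lemma5 : ∀ {h v} (P : PointSet h v) (i j : ℕ) → 1 ≤ i → i ≤ h → 1 ≤ j → j ≤ v →
    (T : MG) → IsPartialTour P i j T →
    ∀ a b c d → R h v i j a → R h v i j b → R h v i j c → R h v i j d →
    row a < row b → row b < row c → row c < row d →
    PosDeg T a → PosDeg T b → PosDeg T c → PosDeg T d →
    SameComponent T a c → SameComponent T b d →
    SameComponent T a b × SameComponent T a c × SameComponent T a d
lemma5 _ _ _ _ _ _ _ T (T⊑L , _) a b c d Ra Rb Rc Rd a<b b<c c<d _ _ _ _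
       (Va , Vc , qs , Q , Q⊆T) (Vb , Vd , b~d) =
  (Va , Vb , a~b) , (Va , Vc , qs , Q , Q⊆T) , (Va , Vd , connected-trans a~b b~d)
  where
  open Connectivity T
  open Separation T T⊑L Ra Rc Q Q⊆T
  b-inside : side b ≡ true
  b-inside = trans (side-R Rb)
    (cong₂ _xor_ (dec-true (row a ≤? row b) (<⇒≤ a<b)) (dec-false (row c ≤? row b) (<⇒≱ b<c)))
  d-outside : side d ≡ false
  d-outside = trans (side-R Rd)
    (cong₂ _xor_ (dec-true (row a ≤? row d) (<⇒≤ (<-trans a<b (<-trans b<c c<d))))
                 (dec-true (row c ≤? row d) (<⇒≤ c<d)))
  a~b : Connected T a b
  a~b = connected-if-sides-differ (proj₁ (proj₂ b~d)) (proj₂ (proj₂ b~d))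
    λ b≡d → contradiction (trans (sym b-inside) (trans b≡d d-outside)) λ ()
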